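{- For any undirected unweighted graph $G=(V,E)$ and any set of node pairs $P\subseteq V\times V$, there is a shortest path tiebreaking scheme $\pi$ in $G$ that is lazy for $P$.
   Context: A shortest path tiebreaking scheme in $G$ is a function $\pi$ mapping each ordered pair of nodes $(s,t)$ to a shortest path in $G$ from $s$ to $t$; for a pair set $Q$, $\pi(Q)$ denotes the union of the edge sets of the paths $\pi(q)$, $q\in Q$. For $s\in V$, $P_s=\{(s,t)\in P: t\in V\}$. In a tree $T$ rooted at $s$, with edges oriented away from $s$, a node $b$ is a branching node if its out-degree is at least 2, and every edge leaving a branching node is a branching edge; $\mathcal{B}(T)$ denotes the set of branching edges. The scheme $\pi$ is lazy for $P$ if (1) for every $s\in V$, the graph $T_s=(V,\pi(P_s))$ is a tree rooted at $s$ (possibly together with isolated nodes), and (2) for every $s\in V$ and all distinct edges $(x,y),(x',y')\in T_s\setminus\mathcal{B}(T_s)$ with $\mathrm{dist}_G(s,y)=\mathrm{dist}_G(s,y')=\mathrm{dist}_G(s,x)+1=\mathrm{dist}_G(s,x')+1$, we have $(x,y')\notin E$ (and symmetrically $(x',y)\notin E$). -}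

module Defs where

open import Data.Nat using (ℕ; zero; suc; _≤_)
open import Data.Fin using (Fin)
open import Data.Bool using (Bool; true; false)
open import Data.List using (List; []; _∷_)
open import Data.List.Membership.Propositional using (_∈_; _∉_)
open import Data.List.Relation.Unary.Unique.Propositional using (Unique)
open import Data.Maybe using (Maybe; just; nothing)
open import Data.Product using (Σ; ∃; _×_; _,_)
open import Data.Sum using (_⊎_)
open import Data.Empty using (⊥)
open import Relation.Binary.PropositionalEquality using (_≡_; _≢_)
open import Relation.Nullary using (¬_)

record Graph (n : ℕ) : Set where
  field
    adj     : Fin n → Fin n → Bool
    adj-sym : ∀ x y → adj x y ≡ adj y x
    adj-irr : ∀ x → adj x x ≡ false

module _ {n : ℕ} where

  V : Set
  V = Fin n

  data Walk (R : V → V → Set) : V → V → Set where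
    []  : ∀ {v} → Walk R v v
    _∷_ : ∀ {u v w} → R u v → Walk R v w → Walk R u w

  len : ∀ {R u v} → Walk R u v → ℕ
  len []       = zero
  len (_ ∷ w)  = suc (len w)

  verts : ∀ {R u v} → Walk R u v → List V
  verts {u = u} []       = u ∷ []
  verts {u = u} (_ ∷ w)  = u ∷ verts w

  verts⁺ : ∀ {R u v} → Walk R u v → List V
  verts⁺ []       = []
  verts⁺ (_ ∷ w)  = verts w

  StepIn : ∀ {R u v} → V → V → Walk R u v → Set
  StepIn x y [] = ⊥
  StepIn {u = u} x y (_∷_ {v = v} _ w) =
    ((u ≡ x × v ≡ y) ⊎ (u ≡ y × v ≡ x)) ⊎ StepIn x y w

module _ {n : ℕ} (G : Graph n) where
  open Graph G

  E : V {n} → V {n} → Set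
  E x y = adj x y ≡ true

  IsShortestPath : ∀ {s t} → Walk E s t → Set
  IsShortestPath {s} {t} p = ∀ (q : Walk E s t) → len p ≤ len q

  Reachable : V {n} → V {n} → Set
  Reachable s t = Walk E s t

  Dist : V {n} → V {n} → ℕ → Set
  Dist s v d = Σ (Walk E s v) λ p → len p ≡ d × IsShortestPath p

  -- A shortest path tiebreaking scheme: each ordered pair (s,t) is mapped to
  -- a shortest s-t path; pairs with no s-t path (disconnected G) are mapped
  -- to nothing.
  SchemeValue : (s t : V {n}) → Maybe (Walk E s t) → Set
  SchemeValue s t (just p) = IsShortestPath p
  SchemeValue s t nothing  = ¬ Reachable s t

  Scheme : Set
  Scheme = (s t : V {n}) → Maybe (Walk E s t)

  IsTiebreakingScheme : Scheme → Set
  IsTiebreakingScheme π = ∀ s t → SchemeValue s t (π s t)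

  -- π(P_s): the undirected edge {x,y} lies on π(s,t) for some (s,t) ∈ P
  PiEdge : Scheme → (P : V {n} → V {n} → Bool) → V {n} → V {n} → V {n} → Set
  PiEdge π P s x y =
    Σ (V {n}) λ t → P s t ≡ true × Σ (Walk E s t) λ p → π s t ≡ just p × StepIn x y p

module _ {n : ℕ} (F : V {n} → V {n} → Set) where

  HasCycle : Set
  HasCycle = Σ (V {n}) λ v → Σ (Walk F v v) λ c → 3 ≤ len c × Unique (verts⁺ c)

  -- (V, F) is a tree rooted at s, possibly together with isolated nodes:
  -- every non-isolated node is connected to s, and there is no cycle.
  IsRootedTree : V {n} → Set
  IsRootedTree s = (∀ x y → F x y → Walk F s x) × ¬ HasCycle

  -- (x,y) is an edge of the tree oriented away from the root s:
  -- x is reached from s by a simple tree path avoiding y.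
  Child : V {n} → V {n} → V {n} → Set
  Child s x y = F x y × Σ (Walk F s x) λ w → Unique (verts w) × y ∉ verts w

  Branching : V {n} → V {n} → Set
  Branching s b = Σ (V {n}) λ y → Σ (V {n}) λ y' → y ≢ y' × Child s b y × Child s b y'

  BranchingEdge : V {n} → V {n} → V {n} → Set
  BranchingEdge s x y = Child s x y × Branching s x

module _ {n : ℕ} (G : Graph n) where

  IsLazy : Scheme G → (P : V {n} → V {n} → Bool) → Set
  IsLazy π P = ∀ (s : V {n}) →
      IsRootedTree (PiEdge G π P s) s
    × (∀ x y x' y' →
         Child (PiEdge G π P s) s x y → Child (PiEdge G π P s) s x' y' →
         ¬ Branching (PiEdge G π P s) s x → ¬ Branching (PiEdge G π P s) s x' →
         (x , y) ≢ (x' , y') →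
         ∀ d → Dist G s y (suc d) → Dist G s y' (suc d) → Dist G s x d → Dist G s x' d →
         ¬ E G x y' × ¬ E G x' y)

module Submission where

-- For each source s, fix a BFS parent function f (every reachable v ≠ s is assigned a neighbour one
-- level closer to s) and let π(s,t) be the path of f-ancestors of t.  The union of these paths over the
-- targets of s is the part of the BFS tree spanned by the targets, hence a rooted tree.  If laziness
-- fails at two non-branching edges (x,y), (x′,y′) of one level because x is adjacent to y′, re-hang y′
-- below x: f stays a BFS parent function, x′ loses its only child and no vertex becomes internal.  So
-- the number of internal vertices of the tree drops, and after finitely many repairs the scheme is lazy.

open import Defs
open import Data.Bool using (Bool; true)
import Data.Bool as Bool
open import Data.Empty using (⊥-elim)
open import Data.Fin using (Fin)
import Data.Fin as Fin
open import Data.Fin.Properties using (any?; all?; injective⇒≤)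
open import Data.List using (List; []; _∷_; _++_; length; lookup; reverse; filter; allFin)
open import Data.List.Properties using (unfold-reverse; length-filter; length-tabulate; filter-notAll; filter-reject)
open import Data.List.Membership.Propositional using (_∈_; _∉_)
open import Data.List.Membership.Propositional.Properties using (∈-lookup; ∈-filter⁺; ∈-allFin)
import Data.List.Relation.Binary.Permutation.Setoid.Properties as Perm
open import Data.List.Relation.Unary.Any using (here; there)
import Data.List.Relation.Unary.Any as Any
import Data.List.Relation.Unary.All as All
open import Data.List.Relation.Unary.All.Properties using (¬Any⇒All¬)
open import Data.List.Relation.Unary.AllPairs using ([]; _∷_)
open import Data.List.Relation.Unary.Unique.Propositional using (Unique)
open import Data.Maybe using (Maybe; just; nothing)
open import Data.Nat using (ℕ; zero; suc; _+_; _≤_; _<_; z≤n; s≤s; _<?_)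
import Data.Nat as ℕ
open import Data.Nat.Properties
  using ( ≤-refl; ≤-trans; ≤-reflexive; ≤-antisym; ≤-pred; <-irrefl; <-trans; <-≤-trans; <⇒≤; ≮⇒≥
        ; m≤n⇒m≤1+n; n≤1+n; n≤0⇒n≡0; m<1+n⇒m<n∨m≡n; +-suc; +-identityʳ; +-comm; suc-injective
        ; module ≤-Reasoning)
open import Data.Product using (Σ; _×_; _,_; proj₁; proj₂)
open import Data.Sum using (_⊎_; inj₁; inj₂; swap)
open import Relation.Binary.PropositionalEquality
open import Relation.Nullary using (¬_; Dec; yes; no; ¬?)
open import Relation.Nullary.Decidable using (_×-dec_; _⊎-dec_; _→-dec_)

Unique-head : ∀ {A : Set} {x : A} {xs} → Unique (x ∷ xs) → x ∉ xs
Unique-head (x≢xs ∷ _) x∈xs = All.lookup x≢xs x∈xs refl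

Unique-tail : ∀ {A : Set} {x : A} {xs} → Unique (x ∷ xs) → Unique xs
Unique-tail (_ ∷ u) = u

Unique-cons : ∀ {A : Set} {x : A} {xs} → x ∉ xs → Unique xs → Unique (x ∷ xs)
Unique-cons x∉xs u = ¬Any⇒All¬ _ x∉xs ∷ u

Unique-reverse : ∀ {A : Set} (xs : List A) → Unique xs → Unique (reverse xs)
Unique-reverse {A} xs = Unique-resp-↭ (↭-sym (↭-reverse xs))
  where
  open Perm (setoid A) using (Unique-resp-↭; ↭-reverse)
  open import Data.List.Relation.Binary.Permutation.Setoid (setoid A) using (↭-sym)

Unique⇒length≤ : ∀ {n} (xs : List (Fin n)) → Unique xs → length xs ≤ n
Unique⇒length≤ xs u = injective⇒≤ (lookup-injective xs u)
  where
  lookup-injective : ∀ {A : Set} (xs : List A) → Unique xs → ∀ {i j} → lookup xs i ≡ lookup xs j → i ≡ j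
  lookup-injective (x ∷ xs) u {Fin.zero} {Fin.zero} e = refl
  lookup-injective (x ∷ xs) u {Fin.zero} {Fin.suc j} e = ⊥-elim (Unique-head u (subst (_∈ xs) (sym e) (∈-lookup j)))
  lookup-injective (x ∷ xs) u {Fin.suc i} {Fin.zero} e = ⊥-elim (Unique-head u (subst (_∈ xs) e (∈-lookup i)))
  lookup-injective (x ∷ xs) u {Fin.suc i} {Fin.suc j} e = cong Fin.suc (lookup-injective xs (Unique-tail u) e)

module _ {n : ℕ} {R : V {n} → V {n} → Set} where
  open import Data.List.Membership.DecPropositional (Fin._≟_ {n}) using (_∈?_)

  infixr 5 _++ᵂ_

  _++ᵂ_ : ∀ {a b c} → Walk R a b → Walk R b c → Walk R a c
  [] ++ᵂ q = q
  (e ∷ p) ++ᵂ q = e ∷ (p ++ᵂ q)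

  len-++ᵂ : ∀ {a b c} (p : Walk R a b) (q : Walk R b c) → len (p ++ᵂ q) ≡ len p + len q
  len-++ᵂ [] q = refl
  len-++ᵂ (e ∷ p) q = cong suc (len-++ᵂ p q)

  len-snoc : ∀ {a b c} (p : Walk R a b) (e : R b c) → len (p ++ᵂ e ∷ []) ≡ suc (len p)
  len-snoc p e = trans (len-++ᵂ p (e ∷ [])) (+-comm (len p) 1)

  verts-start : ∀ {a b} (p : Walk R a b) → verts p ≡ a ∷ verts⁺ p
  verts-start [] = refl
  verts-start (e ∷ p) = refl

  verts-++ᵂ : ∀ {a b c} (p : Walk R a b) (q : Walk R b c) → verts (p ++ᵂ q) ≡ verts p ++ verts⁺ q
  verts-++ᵂ [] q = verts-start q
  verts-++ᵂ (e ∷ p) q = cong (_ ∷_) (verts-++ᵂ p q)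

  length-verts : ∀ {a b} (p : Walk R a b) → length (verts p) ≡ suc (len p)
  length-verts [] = refl
  length-verts (e ∷ p) = cong suc (length-verts p)

  start∈verts : ∀ {a b} (p : Walk R a b) → a ∈ verts p
  start∈verts p rewrite verts-start p = here refl

  end∈verts : ∀ {a b} (p : Walk R a b) → b ∈ verts p
  end∈verts [] = here refl
  end∈verts (e ∷ p) = there (end∈verts p)

  closed-walk-not-unique : ∀ {a} (p : Walk R a a) → 0 < len p → ¬ Unique (verts p)
  closed-walk-not-unique (e ∷ p) _ u = Unique-head u (end∈verts p)

  StepIn-++ᵂ⁻ : ∀ {x y a b c} (p : Walk R a b) (q : Walk R b c) →
                StepIn x y (p ++ᵂ q) → StepIn x y p ⊎ StepIn x y q
  StepIn-++ᵂ⁻ [] q st = inj₂ st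
  StepIn-++ᵂ⁻ (e ∷ p) q (inj₁ st) = inj₁ (inj₁ st)
  StepIn-++ᵂ⁻ (e ∷ p) q (inj₂ st) with StepIn-++ᵂ⁻ p q st
  ... | inj₁ st′ = inj₁ (inj₂ st′)
  ... | inj₂ st′ = inj₂ st′

  StepIn-++ᵂˡ : ∀ {x y a b c} (p : Walk R a b) (q : Walk R b c) → StepIn x y p → StepIn x y (p ++ᵂ q)
  StepIn-++ᵂˡ (e ∷ p) q (inj₁ st) = inj₁ st
  StepIn-++ᵂˡ (e ∷ p) q (inj₂ st) = inj₂ (StepIn-++ᵂˡ p q st)

  StepIn-++ᵂʳ : ∀ {x y a b c} (p : Walk R a b) (q : Walk R b c) → StepIn x y q → StepIn x y (p ++ᵂ q)
  StepIn-++ᵂʳ [] q st = st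
  StepIn-++ᵂʳ (e ∷ p) q st = inj₂ (StepIn-++ᵂʳ p q st)

  unsnoc : ∀ {a c} k (p : Walk R a c) → len p ≡ suc k →
           Σ _ λ b → Σ (Walk R a b) λ p′ → len p′ ≡ k × R b c
  unsnoc zero (e ∷ []) refl = _ , [] , refl , e
  unsnoc (suc k) (e ∷ p) eq with unsnoc k p (suc-injective eq)
  ... | b , p′ , eq′ , r = b , e ∷ p′ , cong suc eq′ , r

  dropUntil : ∀ {a b u} (p : Walk R a b) → u ∈ verts p →
              Σ (Walk R u b) λ q → len q ≤ len p × (Unique (verts p) → Unique (verts q))
  dropUntil [] (here refl) = [] , ≤-refl , λ u → u
  dropUntil (e ∷ p) (here refl) = e ∷ p , ≤-refl , λ u → u
  dropUntil (e ∷ p) (there m) with dropUntil p m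
  ... | q , q≤p , uq = q , m≤n⇒m≤1+n q≤p , λ u → uq (Unique-tail u)

  loopErase : ∀ {a b} (p : Walk R a b) → Σ (Walk R a b) λ q → len q ≤ len p × Unique (verts q)
  loopErase [] = [] , ≤-refl , All.[] ∷ []
  loopErase {a} (e ∷ p) with loopErase p
  ... | q , q≤p , uq with a ∈? verts q
  ...   | yes a∈q = let r , r≤q , ur = dropUntil q a∈q in r , m≤n⇒m≤1+n (≤-trans r≤q q≤p) , ur uq
  ...   | no a∉q = e ∷ q , s≤s q≤p , Unique-cons a∉q uq

  module _ (sym-R : ∀ {a b} → R a b → R b a) where

    reverseᵂ : ∀ {a b} → Walk R a b → Walk R b a
    reverseᵂ [] = []
    reverseᵂ (e ∷ p) = reverseᵂ p ++ᵂ sym-R e ∷ []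

    len-reverseᵂ : ∀ {a b} (p : Walk R a b) → len (reverseᵂ p) ≡ len p
    len-reverseᵂ [] = refl
    len-reverseᵂ (e ∷ p) = trans (len-snoc (reverseᵂ p) (sym-R e)) (cong suc (len-reverseᵂ p))

    verts-reverseᵂ : ∀ {a b} (p : Walk R a b) → verts (reverseᵂ p) ≡ reverse (verts p)
    verts-reverseᵂ [] = refl
    verts-reverseᵂ {a} (e ∷ p) = begin
      verts (reverseᵂ p ++ᵂ sym-R e ∷ [])  ≡⟨ verts-++ᵂ (reverseᵂ p) (sym-R e ∷ []) ⟩
      verts (reverseᵂ p) ++ a ∷ []         ≡⟨ cong (_++ a ∷ []) (verts-reverseᵂ p) ⟩
      reverse (verts p) ++ a ∷ []          ≡⟨ unfold-reverse a (verts p) ⟨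
      reverse (a ∷ verts p)                ∎
      where open ≡-Reasoning

mapᵂ : ∀ {n} {R R′ : V {n} → V {n} → Set} → (∀ {a b} → R a b → R′ a b) →
       ∀ {a b} → Walk R a b → Walk R′ a b
mapᵂ g [] = []
mapᵂ g (e ∷ p) = g e ∷ mapᵂ g p

module _ {n} {R R′ : V {n} → V {n} → Set} (g : ∀ {a b} → R a b → R′ a b) where

  verts-mapᵂ : ∀ {a b} (p : Walk R a b) → verts (mapᵂ g p) ≡ verts p
  verts-mapᵂ [] = refl
  verts-mapᵂ (e ∷ p) = cong (_ ∷_) (verts-mapᵂ p)

  verts⁺-mapᵂ : ∀ {a b} (p : Walk R a b) → verts⁺ (mapᵂ g p) ≡ verts⁺ p
  verts⁺-mapᵂ [] = refl
  verts⁺-mapᵂ (e ∷ p) = verts-mapᵂ p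

  len-mapᵂ : ∀ {a b} (p : Walk R a b) → len (mapᵂ g p) ≡ len p
  len-mapᵂ [] = refl
  len-mapᵂ (e ∷ p) = cong suc (len-mapᵂ p)

  HasCycle-map : HasCycle R → HasCycle R′
  HasCycle-map (v , c , 3≤c , uc) =
    v , mapᵂ g c , subst (3 ≤_) (sym (len-mapᵂ c)) 3≤c , subst Unique (sym (verts⁺-mapᵂ c)) uc

m≡1+n⇒0<m : ∀ {m n} → m ≡ suc n → 0 < m
m≡1+n⇒0<m refl = s≤s z≤n

IsLeast : (ℕ → Set) → ℕ → Set
IsLeast Q k = Q k × (∀ j → Q j → k ≤ j)

module _ {Q : ℕ → Set} (Q? : ∀ k → Dec (Q k)) where

  least : ∀ m → Q m → Σ ℕ (IsLeast Q)
  least m qm = search 0 m (λ _ ()) (subst Q (sym (+-identityʳ m)) qm)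
    where
    search : ∀ i fuel → (∀ j → j < i → ¬ Q j) → Q (fuel + i) → Σ ℕ (IsLeast Q)
    search i fuel below q with Q? i
    ... | yes qi = i , qi , λ j qj → ≮⇒≥ (λ j<i → below j j<i qj)
    search i zero below q | no ¬qi = ⊥-elim (¬qi q)
    search i (suc f) below q | no ¬qi = search (suc i) f below′ (subst Q (sym (+-suc f i)) q)
      where
      below′ : ∀ j → j < suc i → ¬ Q j
      below′ j j<1+i with m<1+n⇒m<n∨m≡n j<1+i
      ... | inj₁ j<i = below j j<i
      ... | inj₂ refl = ¬qi

count : ∀ {n} {Q : Fin n → Set} → (∀ i → Dec (Q i)) → ℕ
count {n} Q? = length (filter Q? (allFin n))

count≤n : ∀ {n} {Q : Fin n → Set} (Q? : ∀ i → Dec (Q i)) → count Q? ≤ n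
count≤n {n} Q? = ≤-trans (length-filter Q? (allFin n)) (≤-reflexive (length-tabulate (λ i → i)))

count-< : ∀ {n} {Q Q′ : Fin n → Set} (Q? : ∀ i → Dec (Q i)) (Q′? : ∀ i → Dec (Q′ i)) →
          (∀ {i} → Q′ i → Q i) → ∀ {x} → Q x → ¬ Q′ x → count Q′? < count Q?
count-< {n} {Q} {Q′} Q? Q′? Q′⊆Q {x} qx ¬q′x = subst (λ xs → length xs < count Q?) (filter-absorb (allFin n))
  (filter-notAll Q′? (filter Q? (allFin n)) (Any.map (λ { refl → ¬q′x }) (∈-filter⁺ Q? (∈-allFin x) qx)))
  where
  filter-absorb : ∀ xs → filter Q′? (filter Q? xs) ≡ filter Q′? xs
  filter-absorb [] = refl
  filter-absorb (y ∷ ys) with Q? y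
  ... | yes _ with Q′? y
  ...   | yes _ = cong (y ∷_) (filter-absorb ys)
  ...   | no _ = filter-absorb ys
  filter-absorb (y ∷ ys) | no ¬qy =
    trans (filter-absorb ys) (sym (filter-reject Q′? (λ q′y → ¬qy (Q′⊆Q q′y))))

module Forest {n : ℕ} (D : V {n} → V {n} → Set) (level : V {n} → ℕ)
  (parent-unique : ∀ {a b c} → D a c → D b c → a ≡ b)
  (level-up : ∀ {a b} → D a b → level a < level b) where

  Undirected : V {n} → V {n} → Set
  Undirected x y = D x y ⊎ D y x

  level-≤-end : ∀ {a b v} (d : Walk D a b) → v ∈ verts d → level v ≤ level b
  level-≤-end [] (here refl) = ≤-refl
  level-≤-end (e ∷ d) (here refl) = ≤-trans (<⇒≤ (level-up e)) (level-≤-end d (start∈verts d))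
  level-≤-end (e ∷ d) (there v∈d) = level-≤-end d v∈d

  level-start-≤ : ∀ {a b v} (d : Walk D a b) → v ∈ verts d → level a ≤ level v
  level-start-≤ [] (here refl) = ≤-refl
  level-start-≤ (e ∷ d) (here refl) = ≤-refl
  level-start-≤ (e ∷ d) (there v∈d) = ≤-trans (<⇒≤ (level-up e)) (level-start-≤ d v∈d)

  descent-unique : ∀ {a b} (d : Walk D a b) → Unique (verts d)
  descent-unique [] = All.[] ∷ []
  descent-unique (e ∷ d) =
    Unique-cons (λ a∈d → <-irrefl refl (<-≤-trans (level-up e) (level-start-≤ d a∈d))) (descent-unique d)

  descend : ∀ {a c b} → D a c → (q : Walk Undirected c b) → Unique (a ∷ verts q) →
            Σ (Walk D c b) λ d → verts d ≡ verts q
  descend _ [] _ = [] , refl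
  descend _ (inj₁ e′ ∷ q) u with descend e′ q (Unique-tail u)
  ... | d , d≡q = e′ ∷ d , cong (_ ∷_) d≡q
  descend e (inj₂ e′ ∷ q) u =
    ⊥-elim (Unique-head u (there (subst (_∈ verts q) (parent-unique e′ e) (start∈verts q))))

  parent∈descent : ∀ {a b y} (d : Walk D a b) → 0 < len d → D y b → y ∈ verts d
  parent∈descent (e ∷ []) _ e′ = here (parent-unique e′ e)
  parent∈descent (_ ∷ e ∷ d) _ e′ = there (parent∈descent (e ∷ d) (s≤s z≤n) e′)

  parent∈simple-walk : ∀ {r x y} → (∀ {a} → ¬ D a r) → (w : Walk Undirected r x) → Unique (verts w) →
                       D y x → y ∈ verts w
  parent∈simple-walk root [] _ e = ⊥-elim (root e)
  parent∈simple-walk root (inj₂ e′ ∷ w) _ _ = ⊥-elim (root e′)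
  parent∈simple-walk {r} {y = y} root (inj₁ e′ ∷ w) u e with descend e′ w u
  ... | d , d≡w = subst (y ∈_) (cong (r ∷_) d≡w) (parent∈descent (e′ ∷ d) (s≤s z≤n) e)

  no-return : ∀ {a c} → D a c → (q : Walk Undirected c a) → 2 ≤ len q → ¬ Unique (verts q)
  no-return e (inj₁ e′ ∷ q) _ u with descend e′ q u
  ... | d , _ = <-irrefl refl (<-trans (level-up e) (<-≤-trans (level-up e′) (level-≤-end d (start∈verts d))))
  no-return e (inj₂ e′ ∷ q) (s≤s 1≤q) u with parent-unique e′ e
  ... | refl = closed-walk-not-unique q 1≤q (Unique-tail u)

  acyclic : ¬ HasCycle Undirected
  acyclic (_ , inj₁ e ∷ q , s≤s 2≤q , u) = no-return e q 2≤q u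
  acyclic (_ , inj₂ e ∷ q , s≤s 2≤q , u) =
    no-return e (reverseᵂ swap q) (subst (2 ≤_) (sym (len-reverseᵂ swap q)) 2≤q)
      (subst Unique (sym (verts-reverseᵂ swap q)) (Unique-reverse _ u))

module Distances {n : ℕ} (G : Graph n) (s : V {n}) where
  open Graph G

  E? : ∀ a b → Dec (E G a b)
  E? a b = adj a b Bool.≟ true

  E-sym : ∀ {a b} → E G a b → E G b a
  E-sym {a} {b} e = trans (adj-sym b a) e

  Reach : V {n} → Set
  Reach = Reachable G s

  reach-neighbour : ∀ {u v} → Reach v → E G u v → Reach u
  reach-neighbour p e = p ++ᵂ E-sym e ∷ []

  WalkWithin : ℕ → V {n} → V {n} → Set
  WalkWithin zero a b = a ≡ b
  WalkWithin (suc k) a b = a ≡ b ⊎ Σ (V {n}) λ u → E G a u × WalkWithin k u b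

  walkWithin? : ∀ k a b → Dec (WalkWithin k a b)
  walkWithin? zero a b = a Fin.≟ b
  walkWithin? (suc k) a b = (a Fin.≟ b) ⊎-dec any? (λ u → E? a u ×-dec walkWithin? k u b)

  walkWithin⇒walk : ∀ k {a b} → WalkWithin k a b → Σ (Walk (E G) a b) λ p → len p ≤ k
  walkWithin⇒walk zero refl = [] , z≤n
  walkWithin⇒walk (suc k) (inj₁ refl) = [] , z≤n
  walkWithin⇒walk (suc k) (inj₂ (u , e , w)) with walkWithin⇒walk k w
  ... | p , p≤k = e ∷ p , s≤s p≤k

  walk⇒walkWithin : ∀ k {a b} (p : Walk (E G) a b) → len p ≤ k → WalkWithin k a b
  walk⇒walkWithin zero [] _ = refl
  walk⇒walkWithin (suc k) [] _ = inj₁ refl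
  walk⇒walkWithin (suc k) (e ∷ p) (s≤s p≤k) = inj₂ (_ , e , walk⇒walkWithin k p p≤k)

  -- A loop-erased walk visits at most n distinct vertices, so n steps suffice.
  reach⇒walkWithin-n : ∀ {b} → Reach b → WalkWithin n s b
  reach⇒walkWithin-n p with loopErase p
  ... | q , _ , uq = walk⇒walkWithin n q
    (≤-trans (n≤1+n (len q)) (≤-trans (≤-reflexive (sym (length-verts q))) (Unique⇒length≤ (verts q) uq)))

  Reach? : ∀ b → Dec (Reach b)
  Reach? b with walkWithin? n s b
  ... | yes w = yes (proj₁ (walkWithin⇒walk n w))
  ... | no ¬w = no λ p → ¬w (reach⇒walkWithin-n p)

  shortest : ∀ {b} → Reach b → Σ ℕ (IsLeast λ k → WalkWithin k s b)
  shortest {b} p = least (λ k → walkWithin? k s b) (len p) (walk⇒walkWithin _ p ≤-refl)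

  -- dist(s, b), with the junk value 0 on unreachable vertices.
  δ : V {n} → ℕ
  δ b with Reach? b
  ... | yes p = proj₁ (shortest p)
  ... | no _ = 0

  δ-≤ : ∀ {b} (q : Walk (E G) s b) → δ b ≤ len q
  δ-≤ {b} q with Reach? b
  ... | yes p = proj₂ (proj₂ (shortest p)) (len q) (walk⇒walkWithin _ q ≤-refl)
  ... | no ¬p = ⊥-elim (¬p q)

  δ-attained : ∀ {b} → Reach b → Σ (Walk (E G) s b) λ p → len p ≡ δ b
  δ-attained {b} q with Reach? b
  ... | no ¬p = ⊥-elim (¬p q)
  ... | yes p with shortest p
  ...   | k , w , minimal with walkWithin⇒walk k w
  ...     | p′ , p′≤k = p′ , ≤-antisym p′≤k (minimal (len p′) (walk⇒walkWithin _ p′ ≤-refl))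

  δ-shortest : ∀ {b} (p : Walk (E G) s b) → len p ≡ δ b → IsShortestPath G p
  δ-shortest p p≡δ q = subst (_≤ len q) (sym p≡δ) (δ-≤ q)

  Dist⇒δ : ∀ {b d} → Dist G s b d → δ b ≡ d
  Dist⇒δ (p , refl , p-shortest) with δ-attained p
  ... | q , q≡δ = ≤-antisym (δ-≤ p) (subst (len p ≤_) q≡δ (p-shortest q))

  δ-root : δ s ≡ 0
  δ-root = n≤0⇒n≡0 (δ-≤ [])

  δ≡0⇒root : ∀ {b} → Reach b → δ b ≡ 0 → s ≡ b
  δ≡0⇒root p δ≡0 with δ-attained p
  ... | [] , _ = refl
  ... | _ ∷ _ , q≡δ with trans q≡δ δ≡0
  ...   | ()

  parent-exists : ∀ {v k} → Reach v → δ v ≡ suc k → Σ (V {n}) λ u → E G u v × δ u ≡ k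
  parent-exists {v} {k} p δ≡ with δ-attained p
  ... | q , q≡δ with unsnoc _ q (trans q≡δ δ≡)
  ...   | u , q′ , q′≡k , e = u , e , ≤-antisym (subst (δ u ≤_) q′≡k (δ-≤ q′)) k≤δu
    where
    k≤δu : k ≤ δ u
    k≤δu with δ-attained q′
    ... | r , r≡δ = ≤-pred (begin
      suc k                 ≡⟨ δ≡ ⟨
      δ v                   ≤⟨ δ-≤ (r ++ᵂ e ∷ []) ⟩
      len (r ++ᵂ e ∷ [])    ≡⟨ trans (len-snoc r e) (cong suc r≡δ) ⟩
      suc (δ u)             ∎)
      where open ≤-Reasoning

  IsBFSParent : (V {n} → V {n}) → Set
  IsBFSParent f = ∀ v → Reach v → 0 < δ v → E G (f v) v × suc (δ (f v)) ≡ δ v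

  parentVia : ∀ {v} → Reach v → ∀ k → δ v ≡ k → V {n}
  parentVia {v} _ zero _ = v
  parentVia p (suc k) δ≡ = proj₁ (parent-exists p δ≡)

  parentVia-valid : ∀ {v} (p : Reach v) k (δ≡ : δ v ≡ k) → 0 < δ v →
                    E G (parentVia p k δ≡) v × suc (δ (parentVia p k δ≡)) ≡ δ v
  parentVia-valid p zero δ≡ 0<δ = ⊥-elim (<-irrefl (sym δ≡) 0<δ)
  parentVia-valid p (suc k) δ≡ _ =
    let _ , e , δu≡k = parent-exists p δ≡ in e , trans (cong suc δu≡k) (sym δ≡)

  parentOf : ∀ {v} → Dec (Reach v) → V {n}
  parentOf {v} (yes p) = parentVia p (δ v) refl
  parentOf {v} (no _) = v

  bfsParent : V {n} → V {n}
  bfsParent v = parentOf (Reach? v)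

  bfsParent-valid : IsBFSParent bfsParent
  bfsParent-valid v p 0<δ = valid (Reach? v)
    where
    valid : (r : Dec (Reach v)) → E G (parentOf r) v × suc (δ (parentOf r)) ≡ δ v
    valid (yes p′) = parentVia-valid p′ (δ v) refl 0<δ
    valid (no ¬p) = ⊥-elim (¬p p)

module ParentTree {n : ℕ} (G : Graph n) (s : V {n}) (P : V {n} → V {n} → Bool) (f : V {n} → V {n}) where
  open Distances G s

  Target : V {n} → Set
  Target t = P s t ≡ true × Reach t

  Ancestor : ℕ → V {n} → V {n} → Set
  Ancestor zero t w = t ≡ w
  Ancestor (suc k) t w = t ≡ w ⊎ Ancestor k (f t) w

  ancestor? : ∀ k t w → Dec (Ancestor k t w)
  ancestor? zero t w = t Fin.≟ w
  ancestor? (suc k) t w = (t Fin.≟ w) ⊎-dec ancestor? k (f t) w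

  ancestor-refl : ∀ k t → Ancestor k t t
  ancestor-refl zero t = refl
  ancestor-refl (suc k) t = inj₁ refl

  -- The vertices on the π-paths to the targets: ancestors of a target t within δ t steps.
  Marked : V {n} → Set
  Marked w = Σ (V {n}) λ t → Target t × Ancestor (δ t) t w

  marked? : ∀ w → Dec (Marked w)
  marked? w = any? λ t → ((P s t Bool.≟ true) ×-dec Reach? t) ×-dec ancestor? (δ t) t w

  TreeEdge : V {n} → V {n} → Set
  TreeEdge x y = Marked y × 0 < δ y × f y ≡ x

  treeEdge? : ∀ x y → Dec (TreeEdge x y)
  treeEdge? x y = marked? y ×-dec (0 <? δ y) ×-dec (f y Fin.≟ x)

  Internal : V {n} → Set
  Internal x = Σ (V {n}) λ y → TreeEdge x y

  internal? : ∀ x → Dec (Internal x)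
  internal? x = any? (treeEdge? x)

  SoleChild : V {n} → V {n} → Set
  SoleChild x y = ∀ z → TreeEdge x z → z ≡ y

  soleChild? : ∀ x y → Dec (SoleChild x y)
  soleChild? x y = all? λ z → treeEdge? x z →-dec (z Fin.≟ y)

  -- Just what the repair needs: re-attaching y′ below x keeps the BFS levels and makes x′ a leaf.
  Violation : Set
  Violation = Σ (V {n}) λ x → Σ (V {n}) λ x′ → Σ (V {n}) λ y′ →
    Internal x × TreeEdge x′ y′ × δ x ≡ δ x′ × x ≢ x′ × SoleChild x′ y′ × E G x y′

  violation? : Dec Violation
  violation? = any? λ x → any? λ x′ → any? λ y′ →
    internal? x ×-dec treeEdge? x′ y′ ×-dec (δ x ℕ.≟ δ x′) ×-dec ¬? (x Fin.≟ x′) ×-dec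
    soleChild? x′ y′ ×-dec E? x y′

  module _ (valid : IsBFSParent f) where

    climb : ∀ {t k} → Reach t → δ t ≡ suc k → E G (f t) t × Reach (f t) × δ (f t) ≡ k
    climb p δ≡ with valid _ p (m≡1+n⇒0<m δ≡)
    ... | e , δ≡′ = e , reach-neighbour p e , suc-injective (trans δ≡′ δ≡)

    ancestor-closed : (S : V {n} → Set) → (∀ {y} → Reach y → S y → 0 < δ y → S (f y)) →
                      ∀ k {t w} → Reach t → δ t ≡ k → S t → Ancestor k t w → S w
    ancestor-closed S up zero _ _ st refl = st
    ancestor-closed S up (suc k) _ _ st (inj₁ refl) = st
    ancestor-closed S up (suc k) p δ≡ st (inj₂ a) with climb p δ≡
    ... | _ , p′ , δ≡′ = ancestor-closed S up k p′ δ≡′ (up p st (m≡1+n⇒0<m δ≡)) a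

    ancestor-parent : ∀ k {t w} → Reach t → δ t ≡ k → Ancestor k t w → 0 < δ w → Ancestor k t (f w)
    ancestor-parent zero _ δ≡ refl 0<δ = ⊥-elim (<-irrefl (sym δ≡) 0<δ)
    ancestor-parent (suc k) _ _ (inj₁ refl) _ = inj₂ (ancestor-refl k _)
    ancestor-parent (suc k) p δ≡ (inj₂ a) 0<δ with climb p δ≡
    ... | _ , p′ , δ≡′ = inj₂ (ancestor-parent k p′ δ≡′ a 0<δ)

    reach-parent : ∀ {y} → Reach y → 0 < δ y → Reach (f y)
    reach-parent p 0<δ = reach-neighbour p (proj₁ (valid _ p 0<δ))

    marked-least : (S : V {n} → Set) → (∀ {t} → Target t → S t) →
                   (∀ {y} → Reach y → S y → 0 < δ y → S (f y)) → ∀ {w} → Marked w → S w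
    marked-least S target up (t , tt@(_ , p) , a) = ancestor-closed S up (δ t) p refl (target tt) a

    marked-reach : ∀ {w} → Marked w → Reach w
    marked-reach = marked-least Reach proj₂ (λ p _ → reach-parent p)

    marked-parent : ∀ {w} → Marked w → 0 < δ w → Marked (f w)
    marked-parent (t , tt@(_ , p) , a) 0<δ = t , tt , ancestor-parent (δ t) p refl a 0<δ

    treeEdge-parent-unique : ∀ {a b c} → TreeEdge a c → TreeEdge b c → a ≡ b
    treeEdge-parent-unique (_ , _ , fc≡a) (_ , _ , fc≡b) = trans (sym fc≡a) fc≡b

    treeEdge-level : ∀ {x y} → TreeEdge x y → suc (δ x) ≡ δ y
    treeEdge-level (m , 0<δ , refl) = proj₂ (valid _ (marked-reach m) 0<δ)

    treeEdge-level-up : ∀ {x y} → TreeEdge x y → δ x < δ y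
    treeEdge-level-up te = ≤-reflexive (treeEdge-level te)

    no-treeEdge-into-root : ∀ {a} → ¬ TreeEdge a s
    no-treeEdge-into-root (_ , 0<δ , _) = <-irrefl (sym δ-root) 0<δ

    treeEdge-marked : ∀ {x y} → TreeEdge x y → Marked x
    treeEdge-marked (m , 0<δ , refl) = marked-parent m 0<δ

    open Forest TreeEdge δ treeEdge-parent-unique treeEdge-level-up public

    descentTo : ∀ k {w} → Marked w → δ w ≡ k → Walk TreeEdge s w
    descentTo zero m δ≡ with δ≡0⇒root (marked-reach m) δ≡
    ... | refl = []
    descentTo (suc k) m δ≡ =
      descentTo k (marked-parent m 0<δ) (suc-injective (trans (treeEdge-level te) δ≡)) ++ᵂ te ∷ []
      where
      0<δ = m≡1+n⇒0<m δ≡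
      te = m , 0<δ , refl

    chain : ∀ k {t} → Reach t → δ t ≡ k → Walk (E G) s t
    chain zero p δ≡ with δ≡0⇒root p δ≡
    ... | refl = []
    chain (suc k) p δ≡ with climb p δ≡
    ... | e , p′ , δ≡′ = chain k p′ δ≡′ ++ᵂ e ∷ []

    len-chain : ∀ k {t} (p : Reach t) (δ≡ : δ t ≡ k) → len (chain k p δ≡) ≡ k
    len-chain zero p δ≡ with δ≡0⇒root p δ≡
    ... | refl = refl
    len-chain (suc k) p δ≡ = trans (len-snoc (chain k _ _) _) (cong suc (len-chain k _ _))

    Link : V {n} → V {n} → V {n} → Set
    Link x y w = (f w ≡ x × w ≡ y) ⊎ (f w ≡ y × w ≡ x)

    chain-step⁻ : ∀ k {t x y} (p : Reach t) (δ≡ : δ t ≡ k) → StepIn x y (chain k p δ≡) →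
                  Σ (V {n}) λ w → Ancestor k t w × 0 < δ w × Link x y w
    chain-step⁻ zero p δ≡ st with δ≡0⇒root p δ≡
    ... | refl = ⊥-elim st
    chain-step⁻ (suc k) p δ≡ st with StepIn-++ᵂ⁻ (chain k _ _) (_ ∷ []) st
    ... | inj₂ (inj₁ link) = _ , inj₁ refl , m≡1+n⇒0<m δ≡ , link
    ... | inj₁ st′ with chain-step⁻ k _ _ st′
    ...   | w , a , 0<δ , link = w , inj₂ a , 0<δ , link

    chain-step⁺ : ∀ k {t w} (p : Reach t) (δ≡ : δ t ≡ k) → Ancestor k t w → 0 < δ w →
                  StepIn (f w) w (chain k p δ≡)
    chain-step⁺ zero p δ≡ refl 0<δ = ⊥-elim (<-irrefl (sym δ≡) 0<δ)
    chain-step⁺ (suc k) p δ≡ (inj₁ refl) _ = StepIn-++ᵂʳ (chain k _ _) (_ ∷ []) (inj₁ (inj₁ (refl , refl)))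
    chain-step⁺ (suc k) p δ≡ (inj₂ a) 0<δ = StepIn-++ᵂˡ (chain k _ _) (_ ∷ []) (chain-step⁺ k _ _ a 0<δ)

    schemeFrom : ∀ {t} → Dec (Reach t) → Maybe (Walk (E G) s t)
    schemeFrom (yes p) = just (chain _ p refl)
    schemeFrom (no _) = nothing

    πₛ : (t : V {n}) → Maybe (Walk (E G) s t)
    πₛ t = schemeFrom (Reach? t)

    πₛ-valid : ∀ t → SchemeValue G s t (πₛ t)
    πₛ-valid t = valid-from (Reach? t)
      where
      valid-from : (r : Dec (Reach t)) → SchemeValue G s t (schemeFrom r)
      valid-from (yes p) = δ-shortest (chain _ p refl) (len-chain _ p refl)
      valid-from (no ¬p) = ¬p

    πₛ-reach : ∀ {t} → Reach t → Σ (Reach t) λ p → πₛ t ≡ just (chain _ p refl)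
    πₛ-reach {t} p = from (Reach? t)
      where
      from : (r : Dec (Reach t)) → Σ (Reach t) λ p′ → schemeFrom r ≡ just (chain _ p′ refl)
      from (yes p′) = p′ , refl
      from (no ¬p) = ⊥-elim (¬p p)

    -- PiEdge G π P s, unfolded, for the scheme π assembled in claim5.
    Edge : V {n} → V {n} → Set
    Edge x y = Σ (V {n}) λ t → P s t ≡ true × Σ (Walk (E G) s t) λ p → πₛ t ≡ just p × StepIn x y p

    Edge⇒Undirected : ∀ {x y} → Edge x y → Undirected x y
    Edge⇒Undirected {x} {y} (t , Pst , p , πₛt≡p , st) = from (Reach? t) p πₛt≡p st
      where
      from : (r : Dec (Reach t)) (p : Walk (E G) s t) → schemeFrom r ≡ just p → StepIn x y p → Undirected x y
      from (yes r) _ refl st with chain-step⁻ _ r refl st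
      ... | w , a , 0<δ , inj₁ (refl , refl) = inj₁ ((t , (Pst , r) , a) , 0<δ , refl)
      ... | w , a , 0<δ , inj₂ (refl , refl) = inj₂ ((t , (Pst , r) , a) , 0<δ , refl)

    treeEdge⇒Edge : ∀ {x y} → TreeEdge x y → Edge x y
    treeEdge⇒Edge ((t , (Pst , r) , a) , 0<δ , refl) with πₛ-reach r
    ... | r′ , πₛt≡p = t , Pst , _ , πₛt≡p , chain-step⁺ _ r′ refl a 0<δ

    Undirected⇒marked : ∀ {x y} → Undirected x y → Marked x
    Undirected⇒marked (inj₁ te) = treeEdge-marked te
    Undirected⇒marked (inj₂ (m , _ , _)) = m

    isRootedTree : IsRootedTree Edge s
    isRootedTree = rooted , λ cycle → acyclic (HasCycle-map Edge⇒Undirected cycle)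
      where
      rooted : ∀ x y → Edge x y → Walk Edge s x
      rooted x y e = mapᵂ treeEdge⇒Edge (descentTo _ (Undirected⇒marked (Edge⇒Undirected e)) refl)

    child⇒treeEdge : ∀ {x y} → Child Edge s x y → TreeEdge x y
    child⇒treeEdge {y = y} (e , w , uw , y∉w) with Edge⇒Undirected e
    ... | inj₁ te = te
    ... | inj₂ te = ⊥-elim (y∉w (subst (y ∈_) (verts-mapᵂ Edge⇒Undirected w)
          (parent∈simple-walk no-treeEdge-into-root (mapᵂ Edge⇒Undirected w)
            (subst Unique (sym (verts-mapᵂ Edge⇒Undirected w)) uw) te)))

    treeEdge⇒child : ∀ {x y} → TreeEdge x y → Child Edge s x y
    treeEdge⇒child {x} {y} te = treeEdge⇒Edge te , mapᵂ treeEdge⇒Edge d , unique , y∉d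
      where
      d = descentTo _ (treeEdge-marked te) refl
      d-verts = verts-mapᵂ treeEdge⇒Edge d

      unique : Unique (verts (mapᵂ treeEdge⇒Edge d))
      unique = subst Unique (sym d-verts) (descent-unique d)

      y∉d : y ∉ verts (mapᵂ treeEdge⇒Edge d)
      y∉d y∈d = <-irrefl refl (<-≤-trans (treeEdge-level-up te) (level-≤-end d (subst (y ∈_) d-verts y∈d)))

    not-branching⇒soleChild : ∀ {x y} → TreeEdge x y → ¬ Branching Edge s x → SoleChild x y
    not-branching⇒soleChild {y = y} te ¬branching z tz with z Fin.≟ y
    ... | yes z≡y = z≡y
    ... | no z≢y =
      ⊥-elim (¬branching (y , z , (λ y≡z → z≢y (sym y≡z)) , treeEdge⇒child te , treeEdge⇒child tz))

    no-violation⇒¬E : ¬ Violation → ∀ {x y x′ y′} → TreeEdge x y → TreeEdge x′ y′ → δ x ≡ δ x′ →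
                       SoleChild x′ y′ → (x , y) ≢ (x′ , y′) → ¬ E G x y′
    no-violation⇒¬E ¬violation {x} {y} {x′} {y′} te te′ δx≡δx′ sole′ xy≢x′y′ e =
      ¬violation (x , x′ , y′ , (y , te) , te′ , δx≡δx′ , x≢x′ , sole′ , e)
      where
      x≢x′ : x ≢ x′
      x≢x′ refl = xy≢x′y′ (cong (x ,_) (sole′ y te))

    no-violation⇒lazy : ¬ Violation → ∀ x y x′ y′ →
      Child Edge s x y → Child Edge s x′ y′ → ¬ Branching Edge s x → ¬ Branching Edge s x′ →
      (x , y) ≢ (x′ , y′) → ∀ d → Dist G s y (suc d) → Dist G s y′ (suc d) → Dist G s x d → Dist G s x′ d →
      ¬ E G x y′ × ¬ E G x′ y
    no-violation⇒lazy ¬v x y x′ y′ c c′ ¬b ¬b′ xy≢x′y′ d _ _ dx dx′ =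
      no-violation⇒¬E ¬v te te′ δx≡δx′ (not-branching⇒soleChild te′ ¬b′) xy≢x′y′ ,
      no-violation⇒¬E ¬v te′ te (sym δx≡δx′) (not-branching⇒soleChild te ¬b) (λ eq → xy≢x′y′ (sym eq))
      where
      te = child⇒treeEdge c
      te′ = child⇒treeEdge c′
      δx≡δx′ = trans (Dist⇒δ dx) (sym (Dist⇒δ dx′))

module Repair {n : ℕ} (G : Graph n) (s : V {n}) (P : V {n} → V {n} → Bool) (f : V {n} → V {n})
  (valid : Distances.IsBFSParent G s f) (x x′ y′ : V {n})
  (x-internal : ParentTree.Internal G s P f x) (te′ : ParentTree.TreeEdge G s P f x′ y′)
  (δx≡δx′ : Distances.δ G s x ≡ Distances.δ G s x′) (x≢x′ : x ≢ x′)
  (sole′ : ParentTree.SoleChild G s P f x′ y′) (e : E G x y′) where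

  open Distances G s
  module Old = ParentTree G s P f

  f′ : V {n} → V {n}
  f′ v with v Fin.≟ y′
  ... | yes _ = x
  ... | no _ = f v

  module New = ParentTree G s P f′

  f′-valid : IsBFSParent f′
  f′-valid v p 0<δ with v Fin.≟ y′
  ... | yes refl = e , trans (cong suc δx≡δx′) (Old.treeEdge-level valid te′)
  ... | no _ = valid v p 0<δ

  new-marked⇒old-marked : ∀ {w} → New.Marked w → Old.Marked w
  new-marked⇒old-marked = New.marked-least f′-valid Old.Marked target up
    where
    target : ∀ {t} → Old.Target t → Old.Marked t
    target {t} tt = t , tt , Old.ancestor-refl (δ t) t

    up : ∀ {y} → Reach y → Old.Marked y → 0 < δ y → Old.Marked (f′ y)
    up {y} _ m 0<δ with y Fin.≟ y′
    ... | yes _ = Old.treeEdge-marked valid (proj₂ x-internal)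
    ... | no _ = Old.marked-parent valid m 0<δ

  new-internal⇒old-internal : ∀ {z} → New.Internal z → Old.Internal z
  new-internal⇒old-internal (w , m , 0<δ , f′w≡z) with w Fin.≟ y′
  ... | yes _ = subst Old.Internal f′w≡z x-internal
  ... | no _ = w , new-marked⇒old-marked m , 0<δ , f′w≡z

  x′-not-new-internal : ¬ New.Internal x′
  x′-not-new-internal (w , m , 0<δ , f′w≡x′) with w Fin.≟ y′
  ... | yes _ = x≢x′ f′w≡x′
  ... | no w≢y′ = w≢y′ (sole′ w (new-marked⇒old-marked m , 0<δ , f′w≡x′))

  fewer-internal : count New.internal? < count Old.internal?
  fewer-internal = count-< Old.internal? New.internal? new-internal⇒old-internal (y′ , te′) x′-not-new-internal

module LazyParent {n : ℕ} (G : Graph n) (s : V {n}) (P : V {n} → V {n} → Bool) where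
  open Distances G s
  open ParentTree G s P

  repair : ∀ f → IsBFSParent f → Violation f →
           Σ (V {n} → V {n}) λ f′ → IsBFSParent f′ × count (internal? f′) < count (internal? f)
  repair f valid (x , x′ , y′ , x-internal , te′ , δx≡δx′ , x≢x′ , sole′ , e) =
    R.f′ , R.f′-valid , R.fewer-internal
    where module R = Repair G s P f valid x x′ y′ x-internal te′ δx≡δx′ x≢x′ sole′ e

  improve : ∀ k f → IsBFSParent f → count (internal? f) < k →
            Σ (V {n} → V {n}) λ f → IsBFSParent f × ¬ Violation f
  improve (suc k) f valid (s≤s c≤k) with violation? f
  ... | no ¬violation = f , valid , ¬violation
  ... | yes violation with repair f valid violation
  ...   | f′ , valid′ , fewer = improve k f′ valid′ (<-≤-trans fewer c≤k)

  lazyParent : Σ (V {n} → V {n}) λ f → IsBFSParent f × ¬ Violation f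
  lazyParent = improve (suc n) bfsParent bfsParent-valid (s≤s (count≤n _))

claim5 : ∀ (n : ℕ) (G : Graph n) (P : Fin n → Fin n → Bool) →
    Σ (Scheme G) λ π → IsTiebreakingScheme G π × IsLazy G π P
claim5 n G P = π , (λ s → Tree.πₛ-valid s (parent-valid s)) ,
  λ s → Tree.isRootedTree s (parent-valid s) , Tree.no-violation⇒lazy s (parent-valid s) (parent-lazy s)
  where
  parent : V {n} → V {n} → V {n}
  parent s = proj₁ (LazyParent.lazyParent G s P)

  parent-valid : ∀ s → Distances.IsBFSParent G s (parent s)
  parent-valid s = proj₁ (proj₂ (LazyParent.lazyParent G s P))

  module Tree (s : V {n}) = ParentTree G s P (parent s)

  parent-lazy : ∀ s → ¬ Tree.Violation s
  parent-lazy s = proj₂ (proj₂ (LazyParent.lazyParent G s P))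

  π : Scheme G
  π s = Tree.πₛ s (parent-valid s)
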